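{- Let $A=(A(1),\ldots,A(n))$ be a $2$-sorted array of elements of a totally ordered set. If $(i,i+3)$ and $(j,j+3)$ are $3$-inversions of $A$ with $i<j$ that cross each other (i.e. $i<j<i+3<j+3$), then $j=i+2$.
   Context: An array $A$ is $k$-sorted if $A(i)\le A(i+k)$ for all $1\le i\le n-k$. A $p$-inversion of $A$ is a pair $(i,i+p)$ with $1\le i<i+p\le n$ and $A(i)>A(i+p)$. -}

module Defs where

open import Level using (Level)
open import Data.Nat using (ℕ; _+_; _<_)
open import Data.Fin using (Fin; fromℕ<)
open import Data.Product using (Σ; _×_)
open import Data.Nat.Properties using (≤-<-trans; m≤m+n)
open import Relation.Binary.Bundles using (TotalOrder)
import Relation.Binary.Construct.NonStrictToStrict as NTS

-- Arrays are 0-indexed: A : Fin n → Carrier, position i (0-based) is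
-- A(i+1) in the paper's 1-based notation. All conditions are shift invariant.
-- from i + k < n, get i < n
lower : {n : ℕ} (i k : ℕ) → i + k < n → i < n
lower i k h = ≤-<-trans (m≤m+n i k) h

module _ {c ℓ₁ ℓ₂ : Level} (O : TotalOrder c ℓ₁ ℓ₂) where
  open TotalOrder O

  _≺_ : Carrier → Carrier → Set _
  _≺_ = NTS._<_ _≈_ _≤_

  KSorted : {n : ℕ} → ℕ → (Fin n → Carrier) → Set _
  KSorted {n} k A = (i : ℕ) (h : i + k < n) →
    A (fromℕ< (lower i k h)) ≤ A (fromℕ< h)

  PInversion : {n : ℕ} → ℕ → (Fin n → Carrier) → ℕ → Set _
  PInversion {n} p A i = Σ (i + p < n) λ h →
    A (fromℕ< h) ≺ A (fromℕ< (lower i p h))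

-- Two crossing 3-inversions start one or two positions apart. One apart is
-- impossible in a 2-sorted array: the two inversions and three 2-sorted steps
-- close the cycle A(i+4) < A(i+1) ≤ A(i+3) < A(i) ≤ A(i+2) ≤ A(i+4).
module Submission where

open import Defs
open import Level using (Level)
open import Data.Nat as ℕ using (ℕ; zero; suc; _+_; _<_; _<?_; s≤s)
open import Data.Nat.Properties using (+-suc; +-assoc; ≤-<-trans; ≤-refl; n≤1+n; m≤m+n; +-mono-≤; +-monoʳ-≤; m≤n⇒m≤1+n)
open import Data.Fin using (Fin; fromℕ<)
open import Data.Product using (_,_)
open import Data.Sum using (_⊎_; inj₁; inj₂)
open import Data.Empty using (⊥; ⊥-elim)
open import Relation.Binary.Bundles using (TotalOrder)
open import Relation.Binary.PropositionalEquality using (_≡_; refl; cong; trans)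
open import Relation.Nullary.Decidable using (recompute)
import Relation.Binary.Construct.NonStrictToStrict as Strict
import Relation.Binary.Reasoning.PartialOrder as PartialOrderReasoning

module _ {c ℓ₁ ℓ₂ : Level} (O : TotalOrder c ℓ₁ ℓ₂) {n : ℕ}
         (A : Fin n → TotalOrder.Carrier O) where

  open TotalOrder O using (Carrier; _≈_; _≤_; poset; module Eq)
  open PartialOrderReasoning poset

  KSorted-≤ : ∀ {k} → KSorted O k A → ∀ i {m} → i + k ≡ m →
              .(i<n : i < n) .(m<n : m < n) → A (fromℕ< i<n) ≤ A (fromℕ< m<n)
  KSorted-≤ sorted i refl _ m<n = sorted i (recompute (_ <? n) m<n)

  PInversion-≺ : ∀ {p i m} → PInversion O p A i → i + p ≡ m →
                 .(i<n : i < n) .(m<n : m < n) → _≺_ O (A (fromℕ< m<n)) (A (fromℕ< i<n))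
  PInversion-≺ (_ , inversion) refl _ _ = inversion

  2-sorted⇒¬adjacent-3-inversions : KSorted O 2 A → ∀ i →
    PInversion O 3 A i → PInversion O 3 A (suc i) → ⊥
  2-sorted⇒¬adjacent-3-inversions sorted i inv inv′@(i+4<n , _) =
    Strict.<-irrefl _≈_ _≤_ Eq.refl (begin-strict
      A[ suc i + 3 ] ≤-refl     <⟨ PInversion-≺ inv′ refl _ _ ⟩
      A[ suc i ] i+1≤i+4        ≤⟨ KSorted-≤ sorted (suc i) refl _ _ ⟩
      A[ suc i + 2 ] i+3≤i+4    <⟨ PInversion-≺ inv (+-suc i 2) _ _ ⟩
      A[ i ] i≤i+4              ≤⟨ KSorted-≤ sorted i refl _ _ ⟩
      A[ i + 2 ] i+2≤i+4        ≤⟨ KSorted-≤ sorted (i + 2) i+2+2≡i+4 _ _ ⟩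
      A[ suc i + 3 ] ≤-refl     ∎)
    where
    A[_] : (k : ℕ) → .(k ℕ.≤ suc i + 3) → Carrier
    A[ k ] k≤i+4 = A (fromℕ< (≤-<-trans k≤i+4 i+4<n))

    i≤i+4 : i ℕ.≤ suc i + 3
    i≤i+4 = m≤n⇒m≤1+n (m≤m+n i 3)

    i+1≤i+4 : suc i ℕ.≤ suc i + 3
    i+1≤i+4 = m≤m+n (suc i) 3

    i+2≤i+4 : i + 2 ℕ.≤ suc i + 3
    i+2≤i+4 = +-mono-≤ (n≤1+n i) (n≤1+n 2)

    i+3≤i+4 : suc i + 2 ℕ.≤ suc i + 3
    i+3≤i+4 = +-monoʳ-≤ (suc i) (n≤1+n 2)

    i+2+2≡i+4 : i + 2 + 2 ≡ suc i + 3
    i+2+2≡i+4 = trans (+-assoc i 2 2) (+-suc i 3)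

<-<+3⇒≡1+⊎≡+2 : ∀ {i j} → i < j → j < i + 3 → j ≡ suc i ⊎ j ≡ i + 2
<-<+3⇒≡1+⊎≡+2 {zero}  {suc zero}             _ _ = inj₁ refl
<-<+3⇒≡1+⊎≡+2 {zero}  {suc (suc zero)}       _ _ = inj₂ refl
<-<+3⇒≡1+⊎≡+2 {zero}  {suc (suc (suc _))}    _ (s≤s (s≤s (s≤s ())))
<-<+3⇒≡1+⊎≡+2 {suc i} {suc j} (s≤s i<j) (s≤s j<i+3) with <-<+3⇒≡1+⊎≡+2 i<j j<i+3
... | inj₁ j≡1+i = inj₁ (cong suc j≡1+i)
... | inj₂ j≡i+2 = inj₂ (cong suc j≡i+2)

lemma7 : {c ℓ₁ ℓ₂ : Level} (O : TotalOrder c ℓ₁ ℓ₂) (n : ℕ)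
         (A : Fin n → TotalOrder.Carrier O) →
         KSorted O 2 A →
         (i j : ℕ) → PInversion O 3 A i → PInversion O 3 A j →
         i < j → j < i + 3 →
         j ≡ i + 2
lemma7 O n A sorted i j inv inv′ i<j j<i+3 with <-<+3⇒≡1+⊎≡+2 i<j j<i+3
... | inj₁ refl   = ⊥-elim (2-sorted⇒¬adjacent-3-inversions O A sorted i inv inv′)
... | inj₂ j≡i+2 = j≡i+2
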